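{- Let $r\ge 3$ and $k\ge 1$ be integers. For $n\ge r$ let $G_n$ be the graph with vertex set $\{(i,X) : 1\le i\le k,\ X\subseteq[n],\ |X|=r\}$, in which $(i,X)$ and $(j,Y)$ are adjacent if and only if either $i=j$ and $X\cap Y=\emptyset$, or $i\ne j$ and $X\cap Y\neq\emptyset$. Then for every $n\ge 2r$, the independence number of $G_n$ is $\alpha(G_n)=\binom{n-1}{r-1}$.
   Context: $[n]=\{1,\dots,n\}$. Thus $G_n$ consists of $k$ copies of the Kneser graph $KG_{n,r}$, with additional edges joining vertices in different copies whose labels intersect. The independence number $\alpha(G)$ is the largest size of a set of pairwise non-adjacent vertices. -}

module Defs where

open import Data.Nat using (ℕ; _≤_)
open import Data.Fin using (Fin)
open import Data.Fin.Subset using (Subset; ∣_∣; _∩_; Empty; Nonempty)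
open import Data.Product using (Σ; _×_; _,_; proj₁; proj₂; ∃)
open import Data.List using (List; length)
open import Data.List.Membership.Propositional using (_∈_)
open import Data.List.Relation.Unary.Unique.Propositional using (Unique)
open import Data.Sum using (_⊎_)
open import Relation.Binary.PropositionalEquality using (_≡_)
open import Relation.Nullary using (¬_)

record Graph : Set₁ where
  field
    Vertex : Set
    Adj    : Vertex → Vertex → Set

open Graph public

IsIndependent : (G : Graph) → List (Vertex G) → Set
IsIndependent G S =
  Unique S × (∀ {u v} → u ∈ S → v ∈ S → ¬ Adj G u v)

IndependenceNumber : Graph → ℕ → Set
IndependenceNumber G m =
  (Σ (List (Vertex G)) λ S → IsIndependent G S × length S ≡ m)
  × (∀ S → IsIndependent G S → length S ≤ m)

-- Vertices (i , X) with i ∈ Fin k (i.e. {1..k}) and X ⊆ [n] (as Fin n), |X| = r.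
GVertex : ℕ → ℕ → ℕ → Set
GVertex k n r = Fin k × (Σ (Subset n) λ X → ∣ X ∣ ≡ r)

GAdj : ∀ {k n r} → GVertex k n r → GVertex k n r → Set
GAdj (i , X , _) (j , Y , _) =
  (i ≡ j × Empty (X ∩ Y)) ⊎ (¬ i ≡ j × Nonempty (X ∩ Y))

G : ℕ → ℕ → ℕ → Graph
G k n r = record { Vertex = GVertex k n r ; Adj = GAdj }

-- An independent set of G_n is a k-coloured family of r-sets in which sets of the same colour meet
-- and sets of different colours are disjoint.  Write B(n) for the largest intersecting family of
-- r-sets in [n]: C(n−1, r−1) for n ≥ 2r by Erdős–Ko–Rado (proved here by shifting, with the tight
-- case n = 2r done by pairing each set with its complement), and all C(n, r) sets below 2r.
-- The first colour class lives in the complement of the union U of the other classes, so by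
-- induction on the number of colours the family has at most B(n − |U|) + B(|U|) ≤ B(n) members;
-- the last step is the superadditivity of B, which needs r ≥ 3.  The star of all r-sets through
-- one point, in a single colour, attains B(n).
module Submission where

open import Defs
open import Data.Nat using (ℕ; _≤_; _*_; _∸_)
open import Data.Nat.Combinatorics using (_C_)

open import Data.Nat hiding (_≤_; _*_; _∸_)
open import Data.Nat.Properties
open import Data.Nat.Combinatorics using (nCk+nC[k+1]≡[n+1]C[k+1]; nCk≡nC[n∸k])
open import Data.Nat.Induction using (<-wellFounded)
open import Data.Nat.ListAction using (sum)
open import Data.Nat.Tactic.RingSolver using (solve-∀)
import Data.Bool.Properties as Bool
open import Data.Empty using (⊥; ⊥-elim)
open import Data.Fin using (Fin; zero; suc)
import Data.Fin.Properties as Fin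
open import Data.Fin.Subset renaming (_∈_ to _∈ₛ_; _∉_ to _∉ₛ_; ⊥ to ∅)
open import Data.Fin.Subset.Properties
open import Data.List using (List; []; _∷_; length; map; _++_)
open import Data.List.Properties using (length-map; length-++; map-∘)
open import Data.List.Membership.Propositional using (_∈_; _∉_; find; lose)
open import Data.List.Membership.Propositional.Properties using (∈-map⁻; ∈-map⁺; ∈-++⁻)
open import Data.List.Relation.Unary.All as All using ([]; _∷_)
open import Data.List.Relation.Unary.Any as Any using (here; there)
open import Data.List.Relation.Unary.Unique.Propositional using (Unique; []; _∷_)
open import Data.List.Relation.Unary.Unique.Propositional.Properties using (map⁺; ++⁺)
open import Data.Product using (Σ; ∃; _×_; _,_; proj₁; proj₂; map₂)
open import Data.Product.Properties using (,-injective)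
open import Data.Sum using (_⊎_; inj₁; inj₂; [_,_]′)
open import Data.Vec using ([]; _∷_; here; there)
open import Data.Vec.Properties using (≡-dec; ∷-injectiveˡ; ∷-injectiveʳ)
open import Function using (_∘_)
open import Function.Definitions using (Injective)
open import Induction.WellFounded using (Acc; acc)
open import Relation.Nullary using (¬_; Dec; yes; no)
open import Relation.Nullary.Decidable using (¬?; _×-dec_; decidable-stable)
open import Relation.Binary.PropositionalEquality

binom : ℕ → ℕ → ℕ
binom n       zero    = 1
binom zero    (suc k) = 0
binom (suc n) (suc k) = binom n k + binom n (suc k)

binom≡C : ∀ n k → binom n k ≡ n C k
binom≡C zero    zero    = refl
binom≡C (suc n) zero    = binom≡C n zero
binom≡C zero    (suc k) = refl
binom≡C (suc n) (suc k) =
  trans (cong₂ _+_ (binom≡C n k) (binom≡C n (suc k))) (nCk+nC[k+1]≡[n+1]C[k+1] n k)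

binom-sym : ∀ m n → binom (m + n) m ≡ binom (m + n) n
binom-sym m n = begin
  binom (m + n) m        ≡⟨ binom≡C (m + n) m ⟩
  (m + n) C m            ≡⟨ nCk≡nC[n∸k] (m≤m+n m n) ⟩
  (m + n) C (m + n ∸ m)  ≡⟨ cong ((m + n) C_) (m+n∸m≡n m n) ⟩
  (m + n) C n            ≡⟨ binom≡C (m + n) n ⟨
  binom (m + n) n        ∎
  where open ≡-Reasoning

binom-+-mono-≤ : ∀ m n k → binom n k ≤ binom (m + n) k
binom-+-mono-≤ zero    n k       = ≤-refl
binom-+-mono-≤ (suc m) n zero    = ≤-refl
binom-+-mono-≤ (suc m) n (suc k) = ≤-trans (binom-+-mono-≤ m n (suc k)) (m≤n+m _ _)

binom-mono-≤ : ∀ {m n} k → m ≤ n → binom m k ≤ binom n k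
binom-mono-≤ {m} {n} k m≤n =
  subst (λ x → binom m k ≤ binom x k) (m∸n+n≡m m≤n) (binom-+-mono-≤ (n ∸ m) m k)

binom-superadditive : ∀ m n k → binom m (suc k) + binom n (suc k) ≤ binom (m + n) (suc k)
binom-superadditive zero    n k = ≤-refl
binom-superadditive (suc m) n k = begin
  binom m k + binom m (suc k) + binom n (suc k)    ≡⟨ +-assoc (binom m k) _ _ ⟩
  binom m k + (binom m (suc k) + binom n (suc k))  ≤⟨ +-mono-≤ (binom-mono-≤ k (m≤m+n m n))
                                                               (binom-superadditive m n k) ⟩
  binom (m + n) k + binom (m + n) (suc k)          ∎
  where open ≤-Reasoning

-- The cross term m · C(n, k+1) counts the (k+2)-sets with one point among the first m and k+1 among the last n.
binom-+-lowerBound : ∀ m n k →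
  binom m (2 + k) + binom n (2 + k) + m * binom n (suc k) ≤ binom (m + n) (2 + k)
binom-+-lowerBound zero    n k = ≤-reflexive (+-identityʳ _)
binom-+-lowerBound (suc m) n k = begin
  binom (suc m) (2 + k) + binom n (2 + k) + suc m * binom n (suc k)
    ≡⟨ regroup (binom m (suc k)) (binom m (2 + k)) (binom n (2 + k)) (binom n (suc k)) m ⟩
  (binom m (suc k) + binom n (suc k)) + (binom m (2 + k) + binom n (2 + k) + m * binom n (suc k))
    ≤⟨ +-mono-≤ (binom-superadditive m n k) (binom-+-lowerBound m n k) ⟩
  binom (suc m + n) (2 + k) ∎
  where
  open ≤-Reasoning
  regroup : ∀ a c d b x → a + c + d + suc x * b ≡ (a + b) + (c + d + x * b)
  regroup = solve-∀

-- (k+1)·C(m,k+1) = (m−k)·C(m,k), with the subtraction moved to the left.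
binom-absorption : ∀ m k → suc k * binom m (suc k) + k * binom m k ≡ m * binom m k
binom-absorption zero    zero    = refl
binom-absorption zero    (suc k) = cong₂ _+_ (*-zeroʳ (2 + k)) (*-zeroʳ (suc k))
binom-absorption (suc m) zero    = cong suc (binom-absorption m zero)
binom-absorption (suc m) (suc j) = begin
  (2 + j) * (b + c) + (1 + j) * (a + b)                     ≡⟨ regroup j a b c ⟩
  ((2 + j) * c + (1 + j) * b) + ((1 + j) * b + j * a) + (a + b)
    ≡⟨ cong₂ (λ u v → u + v + (a + b)) (binom-absorption m (suc j)) (binom-absorption m j) ⟩
  m * b + m * a + (a + b)                                   ≡⟨ collect m a b ⟩
  suc m * (a + b)                                           ∎
  where
  open ≡-Reasoning
  a = binom m j
  b = binom m (suc j)
  c = binom m (2 + j)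
  regroup : ∀ j a b c → (2 + j) * (b + c) + (1 + j) * (a + b)
                      ≡ ((2 + j) * c + (1 + j) * b) + ((1 + j) * b + j * a) + (a + b)
  regroup = solve-∀
  collect : ∀ m a b → m * b + m * a + (a + b) ≡ suc m * (a + b)
  collect = solve-∀

binom-suc≤binom : ∀ m k → m ≤ suc (2 * k) → binom m (suc k) ≤ binom m k
binom-suc≤binom m k m≤2k+1 = *-cancelˡ-≤ (suc k) (+-cancelʳ-≤ (k * binom m k) _ _ (begin
  suc k * binom m (suc k) + k * binom m k  ≡⟨ binom-absorption m k ⟩
  m * binom m k                            ≤⟨ *-monoˡ-≤ (binom m k) m≤2k+1 ⟩
  suc (2 * k) * binom m k                  ≡⟨ cong (_* binom m k) (2k+1≡k+1+k k) ⟩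
  (suc k + k) * binom m k                  ≡⟨ *-distribʳ-+ (binom m k) (suc k) k ⟩
  suc k * binom m k + k * binom m k        ∎))
  where
  open ≤-Reasoning
  2k+1≡k+1+k : ∀ k → suc (2 * k) ≡ suc k + k
  2k+1≡k+1+k = solve-∀

binom-2+≤binom : ∀ m k → m ≤ 2 * suc k → binom m (2 + k) ≤ binom m k
binom-2+≤binom m k m≤2k+2 with m≤n⇒m<n∨m≡n m≤2k+2
... | inj₁ m<2k+2 = ≤-trans (binom-suc≤binom m (suc k) (m≤n⇒m≤1+n m≤2k+2))
                            (binom-suc≤binom m k (≤-pred (subst (m <_) (2[k+1]≡2k+2 k) m<2k+2)))
  where
  2[k+1]≡2k+2 : ∀ k → 2 * suc k ≡ 2 + 2 * k
  2[k+1]≡2k+2 = solve-∀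
... | inj₂ refl = ≤-reflexive (begin
  binom (2 * suc k) (2 + k)      ≡⟨ cong (λ x → binom x (2 + k)) (2[k+1]≡2+k+k k) ⟩
  binom (2 + k + k) (2 + k)      ≡⟨ binom-sym (2 + k) k ⟩
  binom (2 + k + k) k            ≡⟨ cong (λ x → binom x k) (2[k+1]≡2+k+k k) ⟨
  binom (2 * suc k) k            ∎)
  where
  open ≡-Reasoning
  2[k+1]≡2+k+k : ∀ k → 2 * suc k ≡ 2 + k + k
  2[k+1]≡2+k+k = solve-∀

binom-middle : ∀ s → binom (2 * suc s) (suc s) ≡ 2 * binom (suc (2 * s)) s
binom-middle s = begin
  binom (2 * suc s) (suc s)                       ≡⟨ cong (λ x → binom x (suc s)) (2[s+1]≡ s) ⟩
  binom (suc s + s) s + binom (suc s + s) (suc s) ≡⟨ cong (binom (suc s + s) s +_) (binom-sym (suc s) s) ⟩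
  binom (suc s + s) s + binom (suc s + s) s       ≡⟨ cong (λ x → binom x s + binom x s) (s+1+s≡ s) ⟩
  binom (suc (2 * s)) s + binom (suc (2 * s)) s   ≡⟨ cong (binom (suc (2 * s)) s +_) (+-identityʳ _) ⟨
  2 * binom (suc (2 * s)) s                       ∎
  where
  open ≡-Reasoning
  2[s+1]≡ : ∀ s → 2 * suc s ≡ suc (suc s + s)
  2[s+1]≡ = solve-∀
  s+1+s≡ : ∀ s → suc s + s ≡ suc (2 * s)
  s+1+s≡ = solve-∀

-- The Erdős–Ko–Rado bound

-- Below 2r any two r-sets meet, so there the largest intersecting family takes all C(n,r) of them.
ekrBound : ℕ → ℕ → ℕ
ekrBound r n with 2 * r ≤? n
... | yes _ = binom (n ∸ 1) (r ∸ 1)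
... | no  _ = binom n r

ekrBound-large : ∀ {r n} → 2 * r ≤ n → ekrBound r n ≡ binom (n ∸ 1) (r ∸ 1)
ekrBound-large {r} {n} 2r≤n with 2 * r ≤? n
... | yes _   = refl
... | no 2r≰n = ⊥-elim (2r≰n 2r≤n)

ekrBound-small : ∀ {r n} → ¬ 2 * r ≤ n → ekrBound r n ≡ binom n r
ekrBound-small {r} {n} 2r≰n with 2 * r ≤? n
... | yes 2r≤n = ⊥-elim (2r≰n 2r≤n)
... | no  _    = refl

small⇒≤2r-1 : ∀ {n} k → ¬ 2 * suc (suc k) ≤ n → n ≤ suc (2 * suc k)
small⇒≤2r-1 {n} k 2r≰n = ≤-pred (subst (n <_) (2[k+2]≡ k) (≰⇒> 2r≰n))
  where
  2[k+2]≡ : ∀ k → 2 * suc (suc k) ≡ suc (suc (2 * suc k))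
  2[k+2]≡ = solve-∀

ekrBound≤binom-pred : ∀ k n → ekrBound (2 + k) n ≤ binom n (suc k)
ekrBound≤binom-pred k n with 2 * (2 + k) ≤? n
... | yes _    = binom-mono-≤ (suc k) (m∸n≤m n 1)
... | no 2r≰n  = binom-suc≤binom n (suc k) (small⇒≤2r-1 k 2r≰n)

ekrBound-+-oneLarge : ∀ k a b → 2 * (2 + k) ≤ b →
  ekrBound (2 + k) a + ekrBound (2 + k) b ≤ binom (a + b ∸ 1) (suc k)
ekrBound-+-oneLarge k a b 2r≤b = begin
  ekrBound (2 + k) a + ekrBound (2 + k) b   ≡⟨ cong (ekrBound (2 + k) a +_) (ekrBound-large {2 + k} 2r≤b) ⟩
  ekrBound (2 + k) a + binom (b ∸ 1) (suc k) ≤⟨ +-monoˡ-≤ _ (ekrBound≤binom-pred k a) ⟩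
  binom a (suc k) + binom (b ∸ 1) (suc k)    ≤⟨ binom-superadditive a (b ∸ 1) k ⟩
  binom (a + (b ∸ 1)) (suc k)                ≡⟨ cong (λ x → binom x (suc k)) (+-∸-assoc a 1≤b) ⟨
  binom (a + b ∸ 1) (suc k)                  ∎
  where
  open ≤-Reasoning
  1≤b : 1 ≤ b
  1≤b = ≤-trans (s≤s z≤n) 2r≤b

-- Below 2r the sets are few: C(a, r) ≤ C(a, r − 1), and after Pascal's rule on b + 1 the term
-- C(b, r) ≤ C(b, r − 2) is absorbed by the cross term of binom-+-lowerBound.
ekrBound-+-bothSmall : ∀ t a b → 1 ≤ a → ¬ 2 * (3 + t) ≤ a → ¬ 2 * (3 + t) ≤ suc b →
  ekrBound (3 + t) a + ekrBound (3 + t) (suc b) ≤ binom (a + suc b ∸ 1) (2 + t)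
ekrBound-+-bothSmall t a b 1≤a 2r≰a 2r≰b+1 = begin
  ekrBound (3 + t) a + ekrBound (3 + t) (suc b)
    ≡⟨ cong₂ _+_ (ekrBound-small {3 + t} 2r≰a) (ekrBound-small {3 + t} 2r≰b+1) ⟩
  binom a (3 + t) + (binom b (2 + t) + binom b (3 + t))
    ≤⟨ +-mono-≤ (binom-suc≤binom a (2 + t) (small⇒≤2r-1 (suc t) 2r≰a))
                (+-monoʳ-≤ (binom b (2 + t)) C[b,r]≤a*C[b,r-2]) ⟩
  binom a (2 + t) + (binom b (2 + t) + a * binom b (1 + t))
    ≡⟨ +-assoc (binom a (2 + t)) _ _ ⟨
  binom a (2 + t) + binom b (2 + t) + a * binom b (1 + t)
    ≤⟨ binom-+-lowerBound a b t ⟩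
  binom (a + b) (2 + t)
    ≡⟨ cong (λ x → binom (x ∸ 1) (2 + t)) (+-suc a b) ⟨
  binom (a + suc b ∸ 1) (2 + t) ∎
  where
  open ≤-Reasoning
  C[b,r]≤a*C[b,r-2] : binom b (3 + t) ≤ a * binom b (1 + t)
  C[b,r]≤a*C[b,r-2] = ≤-trans (binom-2+≤binom b (suc t) (≤-pred (small⇒≤2r-1 (suc t) 2r≰b+1)))
                              (m≤n*m _ a ⦃ >-nonZero 1≤a ⦄)

ekrBound-+≤ : ∀ t {a b} → 3 + t ≤ a → 3 + t ≤ b →
  ekrBound (3 + t) a + ekrBound (3 + t) b ≤ binom (a + b ∸ 1) (2 + t)
ekrBound-+≤ t {a} {suc b} r≤a r≤b+1 = byCases (2 * (3 + t) ≤? suc b) (2 * (3 + t) ≤? a)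
  where
  byCases : Dec (2 * (3 + t) ≤ suc b) → Dec (2 * (3 + t) ≤ a) →
    ekrBound (3 + t) a + ekrBound (3 + t) (suc b) ≤ binom (a + suc b ∸ 1) (2 + t)
  byCases (yes 2r≤b+1) _          = ekrBound-+-oneLarge (suc t) a (suc b) 2r≤b+1
  byCases (no _)       (yes 2r≤a) =
    subst₂ _≤_ (+-comm (ekrBound (3 + t) (suc b)) _) (cong (λ x → binom (x ∸ 1) (2 + t)) (+-comm (suc b) a))
          (ekrBound-+-oneLarge (suc t) (suc b) a 2r≤a)
  byCases (no 2r≰b+1)  (no 2r≰a)  = ekrBound-+-bothSmall t a b (≤-trans (s≤s z≤n) r≤a) 2r≰a 2r≰b+1

ekrBound-superadditive : ∀ {r a b} → 3 ≤ r → r ≤ a → r ≤ b →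
  ekrBound r a + ekrBound r b ≤ ekrBound r (a + b)
ekrBound-superadditive {_} {a} {b} (s≤s (s≤s (s≤s (z≤n {t})))) r≤a r≤b =
  subst (ekrBound (3 + t) a + ekrBound (3 + t) b ≤_) (sym (ekrBound-large {3 + t} 2r≤a+b)) (ekrBound-+≤ t r≤a r≤b)
  where
  2r≤a+b : 2 * (3 + t) ≤ a + b
  2r≤a+b = subst (_≤ a + b) (sym (cong ((3 + t) +_) (+-identityʳ (3 + t)))) (+-mono-≤ r≤a r≤b)

∣p∪⁅x⁆∣≡1+∣p∣ : ∀ {n} {p : Subset n} {x} → x ∉ₛ p → ∣ p ∪ ⁅ x ⁆ ∣ ≡ suc ∣ p ∣
∣p∪⁅x⁆∣≡1+∣p∣ {p = inside  ∷ p} {zero}  x∉p = ⊥-elim (x∉p here)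
∣p∪⁅x⁆∣≡1+∣p∣ {p = outside ∷ p} {zero}  _   = cong (suc ∘ ∣_∣) (∪-identityʳ p)
∣p∪⁅x⁆∣≡1+∣p∣ {p = inside  ∷ p} {suc x} x∉p = cong suc (∣p∪⁅x⁆∣≡1+∣p∣ (drop-not-there x∉p))
∣p∪⁅x⁆∣≡1+∣p∣ {p = outside ∷ p} {suc x} x∉p = ∣p∪⁅x⁆∣≡1+∣p∣ (drop-not-there x∉p)

∪⁅x⁆-injective : ∀ {n} {p q : Subset n} {x} → x ∉ₛ p → x ∉ₛ q → p ∪ ⁅ x ⁆ ≡ q ∪ ⁅ x ⁆ → p ≡ q
∪⁅x⁆-injective {p = inside  ∷ _} {x = zero} x∉p _ _ = ⊥-elim (x∉p here)
∪⁅x⁆-injective {q = inside  ∷ _} {x = zero} _ x∉q _ = ⊥-elim (x∉q here)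
∪⁅x⁆-injective {p = outside ∷ p} {outside ∷ q} {zero} _ _ eq =
  cong (outside ∷_) (trans (sym (∪-identityʳ p)) (trans (∷-injectiveʳ eq) (∪-identityʳ q)))
∪⁅x⁆-injective {p = s ∷ p} {t ∷ q} {suc x} x∉p x∉q eq =
  cong₂ _∷_ (trans (sym (Bool.∨-identityʳ s)) (trans (∷-injectiveˡ eq) (Bool.∨-identityʳ t)))
            (∪⁅x⁆-injective (drop-not-there x∉p) (drop-not-there x∉q) (∷-injectiveʳ eq))

∣p∣≡0⇒p≡∅ : ∀ {n} {p : Subset n} → ∣ p ∣ ≡ 0 → p ≡ ∅
∣p∣≡0⇒p≡∅ {p = []}          _  = refl
∣p∣≡0⇒p≡∅ {p = outside ∷ p} eq = cong (outside ∷_) (∣p∣≡0⇒p≡∅ eq)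

∣p∣≡1⇒p≡⁅x⁆ : ∀ {n} {p : Subset n} {x} → ∣ p ∣ ≡ 1 → x ∈ₛ p → p ≡ ⁅ x ⁆
∣p∣≡1⇒p≡⁅x⁆ {p = inside  ∷ p} {zero}  eq here        = cong (inside ∷_) (∣p∣≡0⇒p≡∅ (suc-injective eq))
∣p∣≡1⇒p≡⁅x⁆ {p = inside  ∷ p} {suc x} eq (there x∈p) =
  ⊥-elim (∉⊥ (subst (x ∈ₛ_) (∣p∣≡0⇒p≡∅ (suc-injective eq)) x∈p))
∣p∣≡1⇒p≡⁅x⁆ {p = outside ∷ p} {suc x} eq (there x∈p) = cong (outside ∷_) (∣p∣≡1⇒p≡⁅x⁆ eq x∈p)

∁-involutive : ∀ {n} (p : Subset n) → ∁ (∁ p) ≡ p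
∁-involutive []            = refl
∁-involutive (inside  ∷ p) = cong (inside ∷_) (∁-involutive p)
∁-involutive (outside ∷ p) = cong (outside ∷_) (∁-involutive p)

∣∁p∣+∣p∣≡n : ∀ {n} (p : Subset n) → ∣ ∁ p ∣ + ∣ p ∣ ≡ n
∣∁p∣+∣p∣≡n p = trans (cong (_+ ∣ p ∣) (∣∁p∣≡n∸∣p∣ p)) (m∸n+n≡m (∣p∣≤n p))

∩-monoˡ-⊆ : ∀ {n} {p p′ : Subset n} (q : Subset n) → p ⊆ p′ → p ∩ q ⊆ p′ ∩ q
∩-monoˡ-⊆ {p = p} q p⊆p′ x∈p∩q = let (x∈p , x∈q) = x∈p∩q⁻ p q x∈p∩q in x∈p∩q⁺ (p⊆p′ x∈p , x∈q)

∩-sym-Nonempty : ∀ {n} {p q : Subset n} → Nonempty (p ∩ q) → Nonempty (q ∩ p)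
∩-sym-Nonempty {p = p} {q} = subst Nonempty (∩-comm p q)

Nonempty-tail : ∀ {n} {q : Subset n} → Nonempty (outside ∷ q) → Nonempty q
Nonempty-tail (suc x , there x∈q) = x , x∈q

disjoint-∪⁅x⁆ : ∀ {n} {p q : Subset n} {x} → Empty (p ∩ q) → x ∉ₛ p → Empty (p ∩ (q ∪ ⁅ x ⁆))
disjoint-∪⁅x⁆ {p = p} {q} {x} p#q x∉p (y , y∈) with x∈p∩q⁻ p (q ∪ ⁅ x ⁆) y∈
... | y∈p , y∈q∪x with x∈p∪q⁻ q ⁅ x ⁆ y∈q∪x
...   | inj₁ y∈q = p#q (y , x∈p∩q⁺ (y∈p , y∈q))
...   | inj₂ y∈x = x∉p (subst (_∈ₛ p) (x∈⁅y⁆⇒x≡y x y∈x) y∈p)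

∉-there : ∀ {n} {x : Fin n} {p} s → x ∉ₛ p → suc x ∉ₛ (s ∷ p)
∉-there _ x∉p (there x∈p) = x∉p x∈p

∃-outside-both : ∀ {n} (p q : Subset n) → ∣ p ∣ + ∣ q ∣ < n → ∃ λ x → x ∉ₛ p × x ∉ₛ q
∃-outside-both (outside ∷ p) (outside ∷ q) _  = zero , (λ ()) , (λ ())
∃-outside-both (inside  ∷ p) (t ∷ q)       lt =
  let (x , x∉p , x∉q) = ∃-outside-both p q (≤-trans (s≤s (+-monoʳ-≤ ∣ p ∣ (∣p∣≤∣x∷p∣ t q))) (≤-pred lt))
  in suc x , ∉-there inside x∉p , ∉-there t x∉q
∃-outside-both {suc n} (outside ∷ p) (inside  ∷ q) lt =
  let (x , x∉p , x∉q) = ∃-outside-both p q (≤-pred (subst (_< suc n) (+-suc ∣ p ∣ ∣ q ∣) lt))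
  in suc x , ∉-there outside x∉p , ∉-there inside x∉q

⊆⋃ : ∀ {n} {Y : Subset n} {Ys} → Y ∈ Ys → Y ⊆ ⋃ Ys
⊆⋃ {Ys = Y ∷ Ys} (here refl) = p⊆p∪q (⋃ Ys)
⊆⋃ {Ys = Y ∷ Ys} (there Y∈)  = ⊆-trans (⊆⋃ Y∈) (q⊆p∪q Y (⋃ Ys))

∈⋃⁻ : ∀ {n} {x : Fin n} Ys → x ∈ₛ ⋃ Ys → Σ (Subset n) λ Y → Y ∈ Ys × x ∈ₛ Y
∈⋃⁻ {x = x} [] x∈∅ = ⊥-elim (∉⊥ {x = x} x∈∅)
∈⋃⁻ (Y ∷ Ys) x∈ with x∈p∪q⁻ Y (⋃ Ys) x∈
... | inj₁ x∈Y  = Y , here refl , x∈Y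
... | inj₂ x∈Ys = let (Z , Z∈ , x∈Z) = ∈⋃⁻ Ys x∈Ys in Z , there Z∈ , x∈Z

disjoint⇒⊆∁⋃ : ∀ {n} {X : Subset n} Ys → (∀ {Y} → Y ∈ Ys → Empty (X ∩ Y)) → X ⊆ ∁ (⋃ Ys)
disjoint⇒⊆∁⋃ Ys X#Ys {i} i∈X = x∉p⇒x∈∁p λ i∈⋃ →
  let (Y , Y∈ , i∈Y) = ∈⋃⁻ Ys i∈⋃ in X#Ys Y∈ (i , x∈p∩q⁺ (i∈X , i∈Y))

module Partition {A B C : Set} (view : A → B ⊎ C) where

  lefts : List A → List B
  lefts []       = []
  lefts (x ∷ xs) with view x
  ... | inj₁ b = b ∷ lefts xs
  ... | inj₂ _ = lefts xs

  rights : List A → List C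
  rights []       = []
  rights (x ∷ xs) with view x
  ... | inj₁ _ = rights xs
  ... | inj₂ c = c ∷ rights xs

  length-partition : ∀ xs → length xs ≡ length (lefts xs) + length (rights xs)
  length-partition []       = refl
  length-partition (x ∷ xs) with view x
  ... | inj₁ _ = cong suc (length-partition xs)
  ... | inj₂ _ = trans (cong suc (length-partition xs)) (sym (+-suc _ _))

  ∈-lefts⁻ : ∀ xs {b} → b ∈ lefts xs → Σ A λ x → x ∈ xs × view x ≡ inj₁ b
  ∈-lefts⁻ (x ∷ xs) b∈ with view x in eq
  ∈-lefts⁻ (x ∷ xs) (here refl) | inj₁ _ = x , here refl , eq
  ∈-lefts⁻ (x ∷ xs) (there b∈)  | inj₁ _ = let (y , y∈ , e) = ∈-lefts⁻ xs b∈ in y , there y∈ , e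
  ∈-lefts⁻ (x ∷ xs) b∈          | inj₂ _ = let (y , y∈ , e) = ∈-lefts⁻ xs b∈ in y , there y∈ , e

  ∈-rights⁻ : ∀ xs {c} → c ∈ rights xs → Σ A λ x → x ∈ xs × view x ≡ inj₂ c
  ∈-rights⁻ (x ∷ xs) c∈ with view x in eq
  ∈-rights⁻ (x ∷ xs) c∈          | inj₁ _ = let (y , y∈ , e) = ∈-rights⁻ xs c∈ in y , there y∈ , e
  ∈-rights⁻ (x ∷ xs) (here refl) | inj₂ _ = x , here refl , eq
  ∈-rights⁻ (x ∷ xs) (there c∈)  | inj₂ _ = let (y , y∈ , e) = ∈-rights⁻ xs c∈ in y , there y∈ , e

  module _ (view-injective : Injective _≡_ _≡_ view) where

    lefts-unique : ∀ {xs} → Unique xs → Unique (lefts xs)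
    lefts-unique {[]}     []            = []
    lefts-unique {x ∷ xs} (x∉xs ∷ uniq) with view x in eq
    ... | inj₁ b = All.tabulate (λ b′∈ b≡b′ → let (y , y∈ , e) = ∈-lefts⁻ xs b′∈ in
                     All.lookup x∉xs y∈ (view-injective (trans eq (trans (cong inj₁ b≡b′) (sym e)))))
                   ∷ lefts-unique uniq
    ... | inj₂ _ = lefts-unique uniq

    rights-unique : ∀ {xs} → Unique xs → Unique (rights xs)
    rights-unique {[]}     []            = []
    rights-unique {x ∷ xs} (x∉xs ∷ uniq) with view x in eq
    ... | inj₁ _ = rights-unique uniq
    ... | inj₂ c = All.tabulate (λ c′∈ c≡c′ → let (y , y∈ , e) = ∈-rights⁻ xs c′∈ in
                     All.lookup x∉xs y∈ (view-injective (trans eq (trans (cong inj₂ c≡c′) (sym e)))))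
                   ∷ rights-unique uniq

unique-constant-length≤1 : ∀ {A : Set} {a : A} {xs} → Unique xs → (∀ {x} → x ∈ xs → x ≡ a) → length xs ≤ 1
unique-constant-length≤1 {xs = []}         _                  _     = z≤n
unique-constant-length≤1 {xs = _ ∷ []}     _                  _     = s≤s z≤n
unique-constant-length≤1 {xs = _ ∷ _ ∷ _} ((x≢y ∷ _) ∷ _) const =
  ⊥-elim (x≢y (trans (const (here refl)) (sym (const (there (here refl))))))

map⁺-injectiveOn : ∀ {A B : Set} (f : A → B) {xs} → Unique xs →
  (∀ {x y} → x ∈ xs → y ∈ xs → f x ≡ f y → x ≡ y) → Unique (map f xs)
map⁺-injectiveOn f {[]}     []            _   = []
map⁺-injectiveOn f {x ∷ xs} (x∉xs ∷ uniq) inj =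
  All.tabulate fx∉ ∷ map⁺-injectiveOn f uniq (λ x∈ y∈ → inj (there x∈) (there y∈))
  where
  fx∉ : ∀ {z} → z ∈ map f xs → ¬ f x ≡ z
  fx∉ z∈ with ∈-map⁻ f z∈
  ... | y , y∈ , refl = λ fx≡fy → All.lookup x∉xs y∈ (inj (here refl) (there y∈) fx≡fy)

sum-map-< : ∀ {A : Set} (f g : A → ℕ) {xs} → (∀ {x} → x ∈ xs → f x ≤ g x) →
  ∀ {x} → x ∈ xs → f x < g x → sum (map f xs) < sum (map g xs)
sum-map-< f g {y ∷ ys} f≤g (here refl) fy<gy = +-mono-<-≤ fy<gy (sum-map-≤ ys (f≤g ∘ there))
  where
  sum-map-≤ : ∀ xs → (∀ {x} → x ∈ xs → f x ≤ g x) → sum (map f xs) ≤ sum (map g xs)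
  sum-map-≤ []       _   = z≤n
  sum-map-≤ (x ∷ xs) f≤g = +-mono-≤ (f≤g (here refl)) (sum-map-≤ xs (f≤g ∘ there))
sum-map-< f g {y ∷ ys} f≤g (there x∈) fx<gx =
  +-mono-≤-< (f≤g (here refl)) (sum-map-< f g (λ z∈ → f≤g (there z∈)) x∈ fx<gx)

_∈?ᴸ_ : ∀ {n} (X : Subset n) F → Dec (X ∈ F)
X ∈?ᴸ F = Any.any? (≡-dec Bool._≟_ X) F

-- Intersecting families

Uniform : ∀ {n} → ℕ → List (Subset n) → Set
Uniform r F = ∀ {X} → X ∈ F → ∣ X ∣ ≡ r

Intersecting : ∀ {n} → List (Subset n) → Set
Intersecting F = ∀ {X Y} → X ∈ F → Y ∈ F → Nonempty (X ∩ Y)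

record IntersectingFamily {n} (r : ℕ) (F : List (Subset n)) : Set where
  constructor intersectingFamily
  field
    unique       : Unique F
    uniform      : Uniform r F
    intersecting : Intersecting F

headView : ∀ {m} → Subset (suc m) → Subset m ⊎ Subset m
headView (outside ∷ t) = inj₁ t
headView (inside  ∷ t) = inj₂ t

headView-injective : ∀ {m} → Injective _≡_ _≡_ (headView {m})
headView-injective {x = outside ∷ _} {outside ∷ _} refl = refl
headView-injective {x = inside  ∷ _} {inside  ∷ _} refl = refl

deletion link : ∀ {m} → List (Subset (suc m)) → List (Subset m)
deletion = Partition.lefts headView
link     = Partition.rights headView

length-deletion+link : ∀ {m} (F : List (Subset (suc m))) → length F ≡ length (deletion F) + length (link F)
length-deletion+link = Partition.length-partition headView

∈-deletion⁻ : ∀ {m} {F : List (Subset (suc m))} {t} → t ∈ deletion F → outside ∷ t ∈ F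
∈-deletion⁻ {F = F} t∈ with Partition.∈-lefts⁻ headView F t∈
... | X , X∈ , eq = subst (_∈ F) (headView-injective eq) X∈

∈-link⁻ : ∀ {m} {F : List (Subset (suc m))} {t} → t ∈ link F → inside ∷ t ∈ F
∈-link⁻ {F = F} t∈ with Partition.∈-rights⁻ headView F t∈
... | X , X∈ , eq = subst (_∈ F) (headView-injective eq) X∈

deletion-unique : ∀ {m} {F : List (Subset (suc m))} → Unique F → Unique (deletion F)
deletion-unique = Partition.lefts-unique headView headView-injective

link-unique : ∀ {m} {F : List (Subset (suc m))} → Unique F → Unique (link F)
link-unique = Partition.rights-unique headView headView-injective

uniform-length≤binom : ∀ n r {F : List (Subset n)} → Unique F → Uniform r F → length F ≤ binom n r
uniform-length≤binom n       zero    uniq unif = unique-constant-length≤1 uniq (∣p∣≡0⇒p≡∅ ∘ unif)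
uniform-length≤binom zero    (suc r) {[]}     _ _    = z≤n
uniform-length≤binom zero    (suc r) {[] ∷ _} _ unif with unif (here refl)
... | ()
uniform-length≤binom (suc m) (suc r) {F} uniq unif = begin
  length F
    ≡⟨ length-deletion+link F ⟩
  length (deletion F) + length (link F)
    ≤⟨ +-mono-≤ (uniform-length≤binom m (suc r) (deletion-unique uniq) (unif ∘ ∈-deletion⁻))
                (uniform-length≤binom m r (link-unique uniq) (suc-injective ∘ unif ∘ ∈-link⁻)) ⟩
  binom m (suc r) + binom m r
    ≡⟨ +-comm (binom m (suc r)) _ ⟩
  binom (suc m) (suc r) ∎
  where
  open ≤-Reasoning

singletons-length≤1 : ∀ {n} {F : List (Subset n)} → IntersectingFamily 1 F → length F ≤ 1
singletons-length≤1 {F = []}    _ = z≤n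
singletons-length≤1 {F = X ∷ _} (intersectingFamily uniq unif meet) =
  unique-constant-length≤1 uniq λ Y∈ → let (x , x∈Y∩X) = meet Y∈ (here refl)
                                           (x∈Y , x∈X) = x∈p∩q⁻ _ X x∈Y∩X
                                       in trans (∣p∣≡1⇒p≡⁅x⁆ (unif Y∈) x∈Y) (sym (∣p∣≡1⇒p≡⁅x⁆ (unif (here refl)) x∈X))

-- At n = 2r, X ↦ ∁ X maps an intersecting family into the r-sets disjointly from itself.
erdősKoRado-tight : ∀ s {n} → 2 * suc s ≡ n → {F : List (Subset n)} → IntersectingFamily (suc s) F →
  length F ≤ binom (n ∸ 1) s
erdősKoRado-tight s refl {F} (intersectingFamily uniq unif meet) =
  subst (λ x → length F ≤ binom x s) (cong (_∸ 1) (sym (2[s+1]≡ s))) (*-cancelˡ-≤ 2 (begin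
  2 * length F                 ≡⟨ cong (length F +_) (trans (+-identityʳ (length F)) (sym (length-map ∁ F))) ⟩
  length F + length (map ∁ F)  ≡⟨ length-++ F ⟨
  length (F ++ map ∁ F)        ≤⟨ uniform-length≤binom (2 * r) r
                                    (++⁺ uniq (map⁺ ∁-injective uniq) F#∁F) uniform ⟩
  binom (2 * r) r              ≡⟨ binom-middle s ⟩
  2 * binom (suc (2 * s)) s    ∎))
  where
  open ≤-Reasoning
  r = suc s
  2[s+1]≡ : ∀ s → 2 * suc s ≡ suc (suc (2 * s))
  2[s+1]≡ = solve-∀
  ∁-injective : ∀ {X Y : Subset (2 * r)} → ∁ X ≡ ∁ Y → X ≡ Y
  ∁-injective {X} {Y} eq = trans (sym (∁-involutive X)) (trans (cong ∁ eq) (∁-involutive Y))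
  F#∁F : ∀ {X} → ¬ (X ∈ F × X ∈ map ∁ F)
  F#∁F (X∈ , ∁Y∈) with ∈-map⁻ ∁ ∁Y∈
  ... | Y , Y∈ , refl = let (x , x∈) = meet Y∈ X∈ in ∉⊥ (subst (x ∈ₛ_) (∩-inverseʳ Y) x∈)
  ∣∁X∣≡r : ∀ X → ∣ X ∣ ≡ r → ∣ ∁ X ∣ ≡ r
  ∣∁X∣≡r X eq = begin-equality
    ∣ ∁ X ∣         ≡⟨ ∣∁p∣≡n∸∣p∣ X ⟩
    2 * r ∸ ∣ X ∣   ≡⟨ cong₂ _∸_ (cong (r +_) (+-identityʳ r)) eq ⟩
    r + r ∸ r       ≡⟨ m+n∸m≡n r r ⟩
    r               ∎
  uniform : Uniform r (F ++ map ∁ F)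
  uniform Z∈ with ∈-++⁻ F Z∈
  ... | inj₁ Z∈F  = unif Z∈F
  ... | inj₂ Z∈∁F with ∈-map⁻ ∁ Z∈∁F
  ...   | Y , Y∈ , refl = ∣∁X∣≡r Y (unif Y∈)

-- Shifting

zeroCount : ∀ {m} → Subset (suc m) → ℕ
zeroCount (outside ∷ _) = 0
zeroCount (inside  ∷ _) = 1

weight : ∀ {m} → List (Subset (suc m)) → ℕ
weight F = sum (map zeroCount F)

-- In Subset (suc m) the tail is numbered from 1, so move p t is {0} ∪ (1 + t) with 0 traded for 1 + p.
move : ∀ {m} → Fin m → Subset m → Subset (suc m)
move p t = outside ∷ (t ∪ ⁅ p ⁆)

Shifted : ∀ {m} → List (Subset (suc m)) → Set
Shifted F = ∀ {t} p → inside ∷ t ∈ F → p ∉ₛ t → move p t ∈ F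

module Shift {m} (F : List (Subset (suc m))) (p : Fin m) where

  shift : Subset (suc m) → Subset (suc m)
  shift (outside ∷ t) = outside ∷ t
  shift (inside  ∷ t) with p ∈? t | move p t ∈?ᴸ F
  ... | yes _ | _     = inside ∷ t
  ... | no _  | yes _ = inside ∷ t
  ... | no _  | no _  = move p t

  data ShiftCase : Subset (suc m) → Subset (suc m) → Set where
    stays : ∀ {X} → (∀ {t} → X ≡ inside ∷ t → p ∉ₛ t → move p t ∈ F) → ShiftCase X X
    moves : ∀ {t} → p ∉ₛ t → move p t ∉ F → ShiftCase (inside ∷ t) (move p t)

  shiftCase : ∀ X → ShiftCase X (shift X)
  shiftCase (outside ∷ t) = stays λ ()
  shiftCase (inside  ∷ t) with p ∈? t | move p t ∈?ᴸ F
  ... | yes p∈t | _          = stays λ { refl p∉t → ⊥-elim (p∉t p∈t) }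
  ... | no _    | yes move∈F = stays λ { refl _ → move∈F }
  ... | no p∉t  | no move∉F  = moves p∉t move∉F

  shift-preserves-size : ∀ X → ∣ shift X ∣ ≡ ∣ X ∣
  shift-preserves-size X with shift X | shiftCase X
  ... | _ | stays _       = refl
  ... | _ | moves p∉t _   = ∣p∪⁅x⁆∣≡1+∣p∣ p∉t

  shift-injective : ∀ {X Y} → X ∈ F → Y ∈ F → shift X ≡ shift Y → X ≡ Y
  shift-injective {X} {Y} X∈ Y∈ eq with shift X | shiftCase X | shift Y | shiftCase Y
  ... | _ | stays _          | _ | stays _          = eq
  ... | _ | moves p∉t _      | _ | moves p∉u _      =
    cong (inside ∷_) (∪⁅x⁆-injective p∉t p∉u (∷-injectiveʳ eq))
  ... | _ | moves _ move∉F   | _ | stays _          = ⊥-elim (move∉F (subst (_∈ F) (sym eq) Y∈))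
  ... | _ | stays _          | _ | moves _ move∉F   = ⊥-elim (move∉F (subst (_∈ F) eq X∈))

  move-meets : Intersecting F → ∀ {t Y} → inside ∷ t ∈ F → p ∉ₛ t → Y ∈ F →
    (∀ {u} → Y ≡ inside ∷ u → p ∉ₛ u → move p u ∈ F) → Nonempty (move p t ∩ Y)
  move-meets meet {t} {outside ∷ u} t∈ p∉t Y∈ _ with nonempty? (t ∩ u)
  ... | yes (i , i∈t∩u) = suc i , there (∩-monoˡ-⊆ u (p⊆p∪q ⁅ p ⁆) i∈t∩u)
  ... | no t#u          = ⊥-elim (t#u (Nonempty-tail (meet t∈ Y∈)))
  move-meets meet {t} {inside ∷ u} t∈ p∉t Y∈ closed with nonempty? (t ∩ u) | p ∈? u
  ... | yes (i , i∈t∩u) | _      = suc i , there (∩-monoˡ-⊆ u (p⊆p∪q ⁅ p ⁆) i∈t∩u)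
  ... | no _            | yes p∈u = suc p , there (x∈p∩q⁺ (q⊆p∪q t ⁅ p ⁆ (x∈⁅x⁆ p) , p∈u))
  ... | no t#u          | no p∉u  =
    ⊥-elim (disjoint-∪⁅x⁆ t#u p∉t (Nonempty-tail (meet t∈ (closed refl p∉u))))

  shift-meets : Intersecting F → ∀ {X Y} → X ∈ F → Y ∈ F → Nonempty (shift X ∩ shift Y)
  shift-meets meet {X} {Y} X∈ Y∈ with shift X | shiftCase X | shift Y | shiftCase Y
  ... | _ | stays _      | _ | stays _      = meet X∈ Y∈
  ... | _ | moves _ _    | _ | moves _ _    = suc p , there (x∈p∩q⁺ (q⊆p∪q _ ⁅ p ⁆ (x∈⁅x⁆ p) , q⊆p∪q _ ⁅ p ⁆ (x∈⁅x⁆ p)))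
  ... | _ | moves p∉t _  | _ | stays closed = move-meets meet X∈ p∉t Y∈ closed
  ... | _ | stays closed | _ | moves p∉u _  = ∩-sym-Nonempty (move-meets meet Y∈ p∉u X∈ closed)

  shift-family : ∀ {r} → IntersectingFamily r F → IntersectingFamily r (map shift F)
  shift-family {r} (intersectingFamily uniq unif meet) =
    intersectingFamily (map⁺-injectiveOn shift uniq shift-injective) uniform intersecting
    where
    uniform : Uniform r (map shift F)
    uniform Z∈ with ∈-map⁻ shift Z∈
    ... | X , X∈ , refl = trans (shift-preserves-size X) (unif X∈)
    intersecting : Intersecting (map shift F)
    intersecting Z∈ W∈ with ∈-map⁻ shift Z∈ | ∈-map⁻ shift W∈
    ... | X , X∈ , refl | Y , Y∈ , refl = shift-meets meet X∈ Y∈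

  zeroCount-shift≤ : ∀ X → zeroCount (shift X) ≤ zeroCount X
  zeroCount-shift≤ X with shift X | shiftCase X
  ... | _ | stays _   = ≤-refl
  ... | _ | moves _ _ = z≤n

  shift-weight< : ∀ {t} → inside ∷ t ∈ F → p ∉ₛ t → move p t ∉ F → weight (map shift F) < weight F
  shift-weight< {t} t∈ p∉t move∉F =
    subst (_< weight F) (cong sum (map-∘ F))
          (sum-map-< (zeroCount ∘ shift) zeroCount (λ {X} _ → zeroCount-shift≤ X) t∈ moved)
    where
    moved : zeroCount (shift (inside ∷ t)) < 1
    moved with shift (inside ∷ t) | shiftCase (inside ∷ t)
    ... | _ | stays closed = ⊥-elim (move∉F (closed refl p∉t))
    ... | _ | moves _ _    = s≤s z≤n

Violated : ∀ {m} → List (Subset (suc m)) → Subset (suc m) → Set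
Violated F (outside ∷ t) = ⊥
Violated F (inside  ∷ t) = ∃ λ p → p ∉ₛ t × move p t ∉ F

violated? : ∀ {m} (F : List (Subset (suc m))) X → Dec (Violated F X)
violated? F (outside ∷ t) = no λ ()
violated? F (inside  ∷ t) = Fin.any? λ p → ¬? (p ∈? t) ×-dec ¬? (move p t ∈?ᴸ F)

Violation : ∀ {m} → List (Subset (suc m)) → Set
Violation F = ∃ λ t → ∃ λ p → inside ∷ t ∈ F × p ∉ₛ t × move p t ∉ F

shifted-or-violated : ∀ {m} (F : List (Subset (suc m))) → Shifted F ⊎ Violation F
shifted-or-violated F with Any.any? (violated? F) F
... | yes some = violation (find some)
  where
  violation : (∃ λ X → X ∈ F × Violated F X) → Shifted F ⊎ Violation F
  violation (inside ∷ t , t∈ , p , p∉t , move∉F) = inj₂ (t , p , t∈ , p∉t , move∉F)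
... | no none = inj₁ λ p t∈ p∉t →
  decidable-stable (move p _ ∈?ᴸ F) (λ move∉F → none (lose t∈ (p , p∉t , move∉F)))

normalise : ∀ {m r} (F : List (Subset (suc m))) → Acc _<_ (weight F) → IntersectingFamily r F →
  Σ (List (Subset (suc m))) λ F′ → length F′ ≡ length F × IntersectingFamily r F′ × Shifted F′
normalise F (acc smaller) fam with shifted-or-violated F
... | inj₁ shifted = F , refl , fam , shifted
... | inj₂ (t , p , t∈ , p∉t , move∉F) =
  let open Shift F p
      (F′ , same-length , fam′ , shifted) =
        normalise (map shift F) (smaller (shift-weight< t∈ p∉t move∉F)) (shift-family fam)
  in F′ , trans same-length (length-map shift F) , fam′ , shifted

deletion-family : ∀ {m r} {F : List (Subset (suc m))} → IntersectingFamily r F → IntersectingFamily r (deletion F)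
deletion-family (intersectingFamily uniq unif meet) = intersectingFamily
  (deletion-unique uniq) (unif ∘ ∈-deletion⁻) (λ t∈ u∈ → Nonempty-tail (meet (∈-deletion⁻ t∈) (∈-deletion⁻ u∈)))

-- Two disjoint tails leave a free point p; shifting u to u + p forces t to meet u + p, hence u.
link-family : ∀ {m s} {F : List (Subset (suc m))} → 2 * suc s < suc m → IntersectingFamily (suc s) F → Shifted F →
  IntersectingFamily s (link F)
link-family {m} {s} {F} 2r<n (intersectingFamily uniq unif meet) shifted =
  intersectingFamily (link-unique uniq) size intersecting
  where
  size : Uniform s (link F)
  size = suc-injective ∘ unif ∘ ∈-link⁻
  s+s<m : s + s < m
  s+s<m = ≤-trans (n≤1+n _) (≤-pred (subst (_< suc m) (2[s+1]≡ s) 2r<n))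
    where
    2[s+1]≡ : ∀ s → 2 * suc s ≡ 2 + (s + s)
    2[s+1]≡ = solve-∀
  intersecting : Intersecting (link F)
  intersecting {t} {u} t∈ u∈ with nonempty? (t ∩ u)
  ... | yes t∩u≢∅ = t∩u≢∅
  ... | no t#u =
    let (p , p∉t , p∉u) = ∃-outside-both t u (subst (_< m) (sym (cong₂ _+_ (size t∈) (size u∈))) s+s<m)
    in ⊥-elim (disjoint-∪⁅x⁆ t#u p∉t (Nonempty-tail (meet (∈-link⁻ t∈) (shifted p (∈-link⁻ u∈) p∉u))))

-- The Erdős–Ko–Rado theorem

erdősKoRado-step : ∀ m s →
  (∀ s → 2 * suc s ≤ suc m → {F : List (Subset (suc m))} → IntersectingFamily (suc s) F → length F ≤ binom m s) →
  2 * suc (suc s) < suc (suc m) → {F : List (Subset (suc (suc m)))} → IntersectingFamily (suc (suc s)) F →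
  length F ≤ binom (suc m) (suc s)
erdősKoRado-step m s ekr 2r<n {F} fam with normalise F (<-wellFounded (weight F)) fam
... | F′ , same-length , fam′ , shifted = begin
  length F                                ≡⟨ same-length ⟨
  length F′                               ≡⟨ length-deletion+link F′ ⟩
  length (deletion F′) + length (link F′) ≤⟨ +-mono-≤ (ekr (suc s) (≤-pred 2r<n) (deletion-family fam′))
                                                      (ekr s 2r-2≤n-1 (link-family 2r<n fam′ shifted)) ⟩
  binom m (suc s) + binom m s             ≡⟨ +-comm (binom m (suc s)) _ ⟩
  binom (suc m) (suc s)                   ∎
  where
  open ≤-Reasoning
  2r-2≤n-1 : 2 * suc s ≤ suc m
  2r-2≤n-1 = ≤-trans (*-monoʳ-≤ 2 (n≤1+n (suc s))) (≤-pred 2r<n)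

erdősKoRado : ∀ n s → 2 * suc s ≤ n → {F : List (Subset n)} → IntersectingFamily (suc s) F →
  length F ≤ binom (n ∸ 1) s
erdősKoRado n             zero    _        fam = singletons-length≤1 fam
erdősKoRado (suc zero)    (suc s) (s≤s ()) _
erdősKoRado (suc (suc m)) (suc s) 2r≤n     fam =
  [ (λ 2r<n → erdősKoRado-step m s (erdősKoRado (suc m)) 2r<n fam)
  , (λ 2r≡n → erdősKoRado-tight (suc s) 2r≡n fam)
  ]′ (m≤n⇒m<n∨m≡n 2r≤n)

intersecting-length≤ekrBound : ∀ {n} s {F : List (Subset n)} → IntersectingFamily (suc s) F →
  length F ≤ ekrBound (suc s) n
intersecting-length≤ekrBound {n} s fam with 2 * suc s ≤? n
... | yes 2r≤n = erdősKoRado n s 2r≤n fam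
... | no  _    = uniform-length≤binom n (suc s) (IntersectingFamily.unique fam) (IntersectingFamily.uniform fam)

restrict : ∀ {n} (W : Subset n) → Subset n → Subset ∣ W ∣
restrict []            []      = []
restrict (inside  ∷ W) (x ∷ X) = x ∷ restrict W X
restrict (outside ∷ W) (_ ∷ X) = restrict W X

⊆-outside : ∀ {n} {x} {X W : Subset n} → x ∷ X ⊆ outside ∷ W → x ≡ outside
⊆-outside {x = outside} _   = refl
⊆-outside {x = inside}  X⊆W with X⊆W here
... | ()

∣restrict∣ : ∀ {n} {X W : Subset n} → X ⊆ W → ∣ restrict W X ∣ ≡ ∣ X ∣
∣restrict∣ {X = []}          {[]}          _   = refl
∣restrict∣ {X = inside  ∷ X} {inside  ∷ W} X⊆W = cong suc (∣restrict∣ (drop-∷-⊆ X⊆W))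
∣restrict∣ {X = outside ∷ X} {inside  ∷ W} X⊆W = ∣restrict∣ (drop-∷-⊆ X⊆W)
∣restrict∣ {X = x ∷ X}       {outside ∷ W} X⊆W with ⊆-outside X⊆W
... | refl = ∣restrict∣ (drop-∷-⊆ X⊆W)

restrict-injective : ∀ {n} {X Y W : Subset n} → X ⊆ W → Y ⊆ W → restrict W X ≡ restrict W Y → X ≡ Y
restrict-injective {X = []}    {[]}    {[]}          _   _   _  = refl
restrict-injective {X = x ∷ X} {y ∷ Y} {inside  ∷ W} X⊆W Y⊆W eq =
  cong₂ _∷_ (∷-injectiveˡ eq) (restrict-injective (drop-∷-⊆ X⊆W) (drop-∷-⊆ Y⊆W) (∷-injectiveʳ eq))
restrict-injective {X = x ∷ X} {y ∷ Y} {outside ∷ W} X⊆W Y⊆W eq with ⊆-outside X⊆W | ⊆-outside Y⊆W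
... | refl | refl = cong (outside ∷_) (restrict-injective (drop-∷-⊆ X⊆W) (drop-∷-⊆ Y⊆W) eq)

restrict-∩ : ∀ {n} (W X Y : Subset n) → restrict W (X ∩ Y) ≡ restrict W X ∩ restrict W Y
restrict-∩ []            []      []      = refl
restrict-∩ (inside  ∷ W) (x ∷ X) (y ∷ Y) = cong (_ ∷_) (restrict-∩ W X Y)
restrict-∩ (outside ∷ W) (x ∷ X) (y ∷ Y) = restrict-∩ W X Y

Nonempty-restrict⁺ : ∀ {n} {X W : Subset n} → X ⊆ W → Nonempty X → Nonempty (restrict W X)
Nonempty-restrict⁺ {X = x ∷ X} {inside ∷ W} X⊆W (zero , here) = zero , here
Nonempty-restrict⁺ {X = x ∷ X} {inside ∷ W} X⊆W (suc i , there i∈X) =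
  let (j , j∈) = Nonempty-restrict⁺ (drop-∷-⊆ X⊆W) (i , i∈X) in suc j , there j∈
Nonempty-restrict⁺ {X = x ∷ X} {outside ∷ W} X⊆W (zero , here) with X⊆W here
... | ()
Nonempty-restrict⁺ {X = x ∷ X} {outside ∷ W} X⊆W (suc i , there i∈X) =
  Nonempty-restrict⁺ (drop-∷-⊆ X⊆W) (i , i∈X)

Nonempty-restrict⁻ : ∀ {n} (W : Subset n) {X} → Nonempty (restrict W X) → Nonempty X
Nonempty-restrict⁻ (inside  ∷ W) {x ∷ X} (zero , here)        = zero , here
Nonempty-restrict⁻ (inside  ∷ W) {x ∷ X} (suc j , there j∈)   =
  let (i , i∈X) = Nonempty-restrict⁻ W (j , j∈) in suc i , there i∈X
Nonempty-restrict⁻ (outside ∷ W) {x ∷ X} j∈ =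
  let (i , i∈X) = Nonempty-restrict⁻ W j∈ in suc i , there i∈X

restrict-meets⁺ : ∀ {n} {X Y W : Subset n} → X ⊆ W → Nonempty (X ∩ Y) → Nonempty (restrict W X ∩ restrict W Y)
restrict-meets⁺ {X = X} {Y} {W} X⊆W X∩Y≢∅ =
  subst Nonempty (restrict-∩ W X Y) (Nonempty-restrict⁺ (⊆-trans (p∩q⊆p X Y) X⊆W) X∩Y≢∅)

restrict-meets⁻ : ∀ {n} {X Y : Subset n} W → Nonempty (restrict W X ∩ restrict W Y) → Nonempty (X ∩ Y)
restrict-meets⁻ {X = X} {Y} W = Nonempty-restrict⁻ W ∘ subst Nonempty (sym (restrict-∩ W X Y))

restrict-family : ∀ {n r} {F : List (Subset n)} W → (∀ {X} → X ∈ F → X ⊆ W) → IntersectingFamily r F →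
  IntersectingFamily r (map (restrict W) F)
restrict-family {r = r} {F} W ⊆W (intersectingFamily uniq unif meet) = intersectingFamily
  (map⁺-injectiveOn (restrict W) uniq λ X∈ Y∈ → restrict-injective (⊆W X∈) (⊆W Y∈))
  uniform intersecting
  where
  uniform : Uniform r (map (restrict W) F)
  uniform Z∈ with ∈-map⁻ (restrict W) Z∈
  ... | X , X∈ , refl = trans (∣restrict∣ (⊆W X∈)) (unif X∈)
  intersecting : Intersecting (map (restrict W) F)
  intersecting Z∈ Z′∈ with ∈-map⁻ (restrict W) Z∈ | ∈-map⁻ (restrict W) Z′∈
  ... | X , X∈ , refl | Y , Y∈ , refl = restrict-meets⁺ (⊆W X∈) (meet X∈ Y∈)

-- Coloured families

record ColouredFamily {k n} (r : ℕ) (L : List (Fin k × Subset n)) : Set where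
  constructor colouredFamily
  field
    unique      : Unique L
    uniform     : ∀ {i X} → (i , X) ∈ L → ∣ X ∣ ≡ r
    sameColour  : ∀ {i X Y} → (i , X) ∈ L → (i , Y) ∈ L → Nonempty (X ∩ Y)
    otherColour : ∀ {i j X Y} → (i , X) ∈ L → (j , Y) ∈ L → ¬ i ≡ j → Empty (X ∩ Y)

colourView : ∀ {k} {A : Set} → Fin (suc k) × A → A ⊎ (Fin k × A)
colourView (zero  , X) = inj₁ X
colourView (suc j , X) = inj₂ (j , X)

colourView-injective : ∀ {k} {A : Set} → Injective _≡_ _≡_ (colourView {k} {A})
colourView-injective {x = zero  , _} {zero  , _} refl = refl
colourView-injective {x = suc _ , _} {suc _ , _} refl = refl

firstColour : ∀ {k n} → List (Fin (suc k) × Subset n) → List (Subset n)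
firstColour = Partition.lefts colourView

otherColours : ∀ {k n} → List (Fin (suc k) × Subset n) → List (Fin k × Subset n)
otherColours = Partition.rights colourView

∈-firstColour⁻ : ∀ {k n} {L : List (Fin (suc k) × Subset n)} {X} → X ∈ firstColour L → (zero , X) ∈ L
∈-firstColour⁻ {L = L} X∈ with Partition.∈-lefts⁻ colourView L X∈
... | Z , Z∈ , eq = subst (_∈ L) (colourView-injective eq) Z∈

∈-otherColours⁻ : ∀ {k n} {L : List (Fin (suc k) × Subset n)} {j X} → (j , X) ∈ otherColours L → (suc j , X) ∈ L
∈-otherColours⁻ {L = L} X∈ with Partition.∈-rights⁻ colourView L X∈
... | Z , Z∈ , eq = subst (_∈ L) (colourView-injective eq) Z∈

module _ {k n r} {L : List (Fin (suc k) × Subset n)} (col : ColouredFamily r L) where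
  open ColouredFamily col

  firstColour-family : IntersectingFamily r (firstColour L)
  firstColour-family = intersectingFamily
    (Partition.lefts-unique colourView colourView-injective unique)
    (uniform ∘ ∈-firstColour⁻) (λ X∈ Y∈ → sameColour (∈-firstColour⁻ X∈) (∈-firstColour⁻ Y∈))

  otherColours-family : ColouredFamily r (otherColours L)
  otherColours-family = colouredFamily
    (Partition.rights-unique colourView colourView-injective unique)
    (uniform ∘ ∈-otherColours⁻) (λ X∈ Y∈ → sameColour (∈-otherColours⁻ X∈) (∈-otherColours⁻ Y∈))
    (λ X∈ Y∈ i≢j → otherColour (∈-otherColours⁻ X∈) (∈-otherColours⁻ Y∈) (i≢j ∘ Fin.suc-injective))

  firstColour-disjoint : ∀ {X j Y} → X ∈ firstColour L → (j , Y) ∈ otherColours L → Empty (X ∩ Y)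
  firstColour-disjoint X∈ Y∈ = otherColour (∈-firstColour⁻ X∈) (∈-otherColours⁻ Y∈) (λ ())

restrict-coloured : ∀ {k n r} {L : List (Fin k × Subset n)} W → (∀ {j Y} → (j , Y) ∈ L → Y ⊆ W) →
  ColouredFamily r L → ColouredFamily r (map (map₂ (restrict W)) L)
restrict-coloured {r = r} {L} W ⊆W (colouredFamily uniq unif same other) =
  colouredFamily (map⁺-injectiveOn (map₂ (restrict W)) uniq injective) uniform sameColour otherColour
  where
  L′ = map (map₂ (restrict W)) L
  injective : ∀ {A B} → A ∈ L → B ∈ L → map₂ (restrict W) A ≡ map₂ (restrict W) B → A ≡ B
  injective {i , X} {j , Y} X∈ Y∈ eq with ,-injective eq
  ... | refl , rX≡rY = cong (i ,_) (restrict-injective (⊆W X∈) (⊆W Y∈) rX≡rY)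
  uniform : ∀ {i X} → (i , X) ∈ L′ → ∣ X ∣ ≡ r
  uniform Z∈ with ∈-map⁻ (map₂ (restrict W)) Z∈
  ... | (j , Y) , Y∈ , refl = trans (∣restrict∣ (⊆W Y∈)) (unif Y∈)
  sameColour : ∀ {i X Y} → (i , X) ∈ L′ → (i , Y) ∈ L′ → Nonempty (X ∩ Y)
  sameColour Z∈ Z′∈ with ∈-map⁻ (map₂ (restrict W)) Z∈ | ∈-map⁻ (map₂ (restrict W)) Z′∈
  ... | (i , X) , X∈ , refl | (.i , Y) , Y∈ , refl = restrict-meets⁺ (⊆W X∈) (same X∈ Y∈)
  otherColour : ∀ {i j X Y} → (i , X) ∈ L′ → (j , Y) ∈ L′ → ¬ i ≡ j → Empty (X ∩ Y)
  otherColour Z∈ Z′∈ i≢j with ∈-map⁻ (map₂ (restrict W)) Z∈ | ∈-map⁻ (map₂ (restrict W)) Z′∈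
  ... | (i , X) , X∈ , refl | (j , Y) , Y∈ , refl = other X∈ Y∈ i≢j ∘ restrict-meets⁻ W

-- Z lives in the complement U of the union V of the sets of R; both parts are bounded on their own ground sets.
disjoint-union-bound : ∀ {k n t} →
  (∀ {m} {R : List (Fin k × Subset m)} → ColouredFamily (3 + t) R → length R ≤ ekrBound (3 + t) m) →
  ∀ {Z : List (Subset n)} {R : List (Fin k × Subset n)} →
  IntersectingFamily (3 + t) Z → ColouredFamily (3 + t) R → (∀ {X j Y} → X ∈ Z → (j , Y) ∈ R → Empty (X ∩ Y)) →
  length Z + length R ≤ ekrBound (3 + t) n
disjoint-union-bound bound {[]} _ colR _ = bound colR
disjoint-union-bound {t = t} bound {Z} {[]} famZ _ _ =
  subst (_≤ _) (sym (+-identityʳ (length Z))) (intersecting-length≤ekrBound (2 + t) famZ)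
disjoint-union-bound {n = n} {t} bound {Z@(_ ∷ _)} {R@(_ ∷ _)} famZ colR Z#R = begin
  length Z + length R
    ≡⟨ cong₂ _+_ (length-map (restrict U) Z) (length-map (map₂ (restrict V)) R) ⟨
  length Z′ + length R′
    ≤⟨ +-mono-≤ (intersecting-length≤ekrBound (2 + t) (restrict-family U Z⊆U famZ))
                (bound (restrict-coloured V R⊆V colR)) ⟩
  ekrBound (3 + t) ∣ U ∣ + ekrBound (3 + t) ∣ V ∣
    ≤⟨ ekrBound-superadditive (s≤s (s≤s (s≤s z≤n))) r≤∣U∣ r≤∣V∣ ⟩
  ekrBound (3 + t) (∣ U ∣ + ∣ V ∣)
    ≡⟨ cong (ekrBound (3 + t)) (∣∁p∣+∣p∣≡n V) ⟩
  ekrBound (3 + t) n ∎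
  where
  open ≤-Reasoning
  V = ⋃ (map proj₂ R)
  U = ∁ V
  Z′ = map (restrict U) Z
  R′ = map (map₂ (restrict V)) R
  Z⊆U : ∀ {X} → X ∈ Z → X ⊆ U
  Z⊆U X∈ = disjoint⇒⊆∁⋃ (map proj₂ R) λ Y∈ → let (_ , jY∈ , eq) = ∈-map⁻ proj₂ Y∈ in
    subst (λ Y → Empty (_ ∩ Y)) (sym eq) (Z#R X∈ jY∈)
  R⊆V : ∀ {j Y} → (j , Y) ∈ R → Y ⊆ V
  R⊆V jY∈ = ⊆⋃ (∈-map⁺ proj₂ jY∈)
  r≤∣U∣ : 3 + t ≤ ∣ U ∣
  r≤∣U∣ = subst (_≤ ∣ U ∣) (IntersectingFamily.uniform famZ (here refl)) (p⊆q⇒∣p∣≤∣q∣ (Z⊆U (here refl)))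
  r≤∣V∣ : 3 + t ≤ ∣ V ∣
  r≤∣V∣ = subst (_≤ ∣ V ∣) (ColouredFamily.uniform colR (here refl)) (p⊆q⇒∣p∣≤∣q∣ (R⊆V (here refl)))

coloured-length≤ekrBound : ∀ k {n t} {L : List (Fin k × Subset n)} → ColouredFamily (3 + t) L →
  length L ≤ ekrBound (3 + t) n
coloured-length≤ekrBound zero    {L = []}           _   = z≤n
coloured-length≤ekrBound zero    {L = (() , _) ∷ _} _
coloured-length≤ekrBound (suc k) {L = L}            col =
  subst (_≤ _) (sym (Partition.length-partition colourView L))
    (disjoint-union-bound (coloured-length≤ekrBound k)
      (firstColour-family col) (otherColours-family col) (firstColour-disjoint col))

SizedSubset : ℕ → ℕ → Set
SizedSubset m s = Σ (Subset m) λ Y → ∣ Y ∣ ≡ s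

sized-≡ : ∀ {m s} {A B : SizedSubset m s} → proj₁ A ≡ proj₁ B → A ≡ B
sized-≡ {A = Y , e} {.Y , e′} refl = cong (Y ,_) (≡-irrelevant e e′)

extendOut : ∀ {m s} → SizedSubset m s → SizedSubset (suc m) s
extendOut (Y , e) = outside ∷ Y , e

extendIn : ∀ {m s} → SizedSubset m s → SizedSubset (suc m) (suc s)
extendIn (Y , e) = inside ∷ Y , cong suc e

extendOut-injective : ∀ {m s} {A B : SizedSubset m s} → extendOut A ≡ extendOut B → A ≡ B
extendOut-injective eq = sized-≡ (∷-injectiveʳ (cong proj₁ eq))

extendIn-injective : ∀ {m s} {A B : SizedSubset m s} → extendIn A ≡ extendIn B → A ≡ B
extendIn-injective eq = sized-≡ (∷-injectiveʳ (cong proj₁ eq))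

subsetsOfSize : ∀ m s → List (SizedSubset m s)
subsetsOfSize zero    zero    = ([] , refl) ∷ []
subsetsOfSize zero    (suc s) = []
subsetsOfSize (suc m) zero    = map extendOut (subsetsOfSize m zero)
subsetsOfSize (suc m) (suc s) = map extendOut (subsetsOfSize m (suc s)) ++ map extendIn (subsetsOfSize m s)

length-subsetsOfSize : ∀ m s → length (subsetsOfSize m s) ≡ binom m s
length-subsetsOfSize zero    zero    = refl
length-subsetsOfSize zero    (suc s) = refl
length-subsetsOfSize (suc m) zero    =
  trans (length-map extendOut (subsetsOfSize m zero)) (length-subsetsOfSize m zero)
length-subsetsOfSize (suc m) (suc s) = begin
  length (map extendOut (subsetsOfSize m (suc s)) ++ map extendIn (subsetsOfSize m s))
    ≡⟨ length-++ (map extendOut (subsetsOfSize m (suc s))) ⟩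
  length (map extendOut (subsetsOfSize m (suc s))) + length (map extendIn (subsetsOfSize m s))
    ≡⟨ cong₂ _+_ (length-map extendOut (subsetsOfSize m (suc s))) (length-map extendIn (subsetsOfSize m s)) ⟩
  length (subsetsOfSize m (suc s)) + length (subsetsOfSize m s)
    ≡⟨ cong₂ _+_ (length-subsetsOfSize m (suc s)) (length-subsetsOfSize m s) ⟩
  binom m (suc s) + binom m s
    ≡⟨ +-comm (binom m (suc s)) _ ⟩
  binom (suc m) (suc s) ∎
  where open ≡-Reasoning

subsetsOfSize-unique : ∀ m s → Unique (subsetsOfSize m s)
subsetsOfSize-unique zero    zero    = [] ∷ []
subsetsOfSize-unique zero    (suc s) = []
subsetsOfSize-unique (suc m) zero    = map⁺ extendOut-injective (subsetsOfSize-unique m zero)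
subsetsOfSize-unique (suc m) (suc s) =
  ++⁺ (map⁺ extendOut-injective (subsetsOfSize-unique m (suc s)))
      (map⁺ extendIn-injective (subsetsOfSize-unique m s))
      out#in
  where
  out#in : ∀ {A} → ¬ (A ∈ map extendOut (subsetsOfSize m (suc s)) × A ∈ map extendIn (subsetsOfSize m s))
  out#in (out∈ , in∈) with ∈-map⁻ extendOut out∈ | ∈-map⁻ extendIn in∈
  ... | _ , _ , refl | _ , _ , ()

forgetSize : ∀ {k n r} → GVertex k n r → Fin k × Subset n
forgetSize (i , X , _) = i , X

independent⇒coloured : ∀ {k n r} {S : List (GVertex k n r)} → IsIndependent (G k n r) S →
  ColouredFamily r (map forgetSize S)
independent⇒coloured {k} {n} {r} {S} (uniq , indep) =
  colouredFamily (map⁺ forgetSize-injective uniq) uniform sameColour otherColour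
  where
  forgetSize-injective : ∀ {u v : GVertex k n r} → forgetSize u ≡ forgetSize v → u ≡ v
  forgetSize-injective {i , X , e} {.i , .X , e′} refl = cong (λ e → i , X , e) (≡-irrelevant e e′)
  uniform : ∀ {i X} → (i , X) ∈ map forgetSize S → ∣ X ∣ ≡ r
  uniform iX∈ with ∈-map⁻ forgetSize iX∈
  ... | (_ , _ , e) , _ , refl = e
  sameColour : ∀ {i X Y} → (i , X) ∈ map forgetSize S → (i , Y) ∈ map forgetSize S → Nonempty (X ∩ Y)
  sameColour {X = X} {Y} iX∈ iY∈ with ∈-map⁻ forgetSize iX∈ | ∈-map⁻ forgetSize iY∈
  ... | _ , u∈ , refl | _ , v∈ , refl =
    decidable-stable (nonempty? (X ∩ Y)) λ X#Y → indep u∈ v∈ (inj₁ (refl , X#Y))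
  otherColour : ∀ {i j X Y} → (i , X) ∈ map forgetSize S → (j , Y) ∈ map forgetSize S → ¬ i ≡ j → Empty (X ∩ Y)
  otherColour iX∈ jY∈ i≢j X∩Y≢∅ with ∈-map⁻ forgetSize iX∈ | ∈-map⁻ forgetSize jY∈
  ... | _ , u∈ , refl | _ , v∈ , refl = indep u∈ v∈ (inj₂ (i≢j , X∩Y≢∅))

starVertex : ∀ {k m s} → SizedSubset m s → GVertex (suc k) (suc m) (suc s)
starVertex (Y , e) = zero , inside ∷ Y , cong suc e

star : ∀ k m s → List (GVertex (suc k) (suc m) (suc s))
star k m s = map starVertex (subsetsOfSize m s)

length-star : ∀ k m s → length (star k m s) ≡ binom m s
length-star k m s = trans (length-map starVertex (subsetsOfSize m s)) (length-subsetsOfSize m s)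

star-independent : ∀ k m s → IsIndependent (G (suc k) (suc m) (suc s)) (star k m s)
star-independent k m s = map⁺ starVertex-injective (subsetsOfSize-unique m s) , nonadjacent
  where
  starVertex-injective : ∀ {A B : SizedSubset m s} → starVertex {k} A ≡ starVertex B → A ≡ B
  starVertex-injective eq = sized-≡ (∷-injectiveʳ (cong (proj₁ ∘ proj₂) eq))
  nonadjacent : ∀ {u v} → u ∈ star k m s → v ∈ star k m s → ¬ GAdj u v
  nonadjacent u∈ v∈ adj with ∈-map⁻ starVertex u∈ | ∈-map⁻ starVertex v∈
  nonadjacent u∈ v∈ (inj₁ (_ , X#Y))   | _ , _ , refl | _ , _ , refl = X#Y (zero , here)
  nonadjacent u∈ v∈ (inj₂ (0≢0 , _))   | _ , _ , refl | _ , _ , refl = 0≢0 refl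

proposition4p16 : (r k n : ℕ) → 3 ≤ r → 1 ≤ k → 2 * r ≤ n →
    IndependenceNumber (G k n r) ((n ∸ 1) C (r ∸ 1))
proposition4p16 _ (suc k) (suc m) (s≤s (s≤s (s≤s (z≤n {t})))) _ 2r≤n =
  (star k m (2 + t) , star-independent k m (2 + t) , trans (length-star k m (2 + t)) (binom≡C m (2 + t)))
  , λ S indep → begin
      length S                             ≡⟨ length-map forgetSize S ⟨
      length (map forgetSize S)            ≤⟨ coloured-length≤ekrBound (suc k) (independent⇒coloured indep) ⟩
      ekrBound (3 + t) (suc m)             ≡⟨ ekrBound-large {3 + t} 2r≤n ⟩
      binom m (2 + t)                      ≡⟨ binom≡C m (2 + t) ⟩
      m C (2 + t)                          ∎
  where open ≤-Reasoning
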